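{- If $\pi$ is a nonempty permutation, then $s^t(\operatorname{del}_1(\pi))=\operatorname{del}_1(s^t(\pi))$ for every integer $t\geq 0$.
   Context: A permutation is an ordering of a finite set of positive integers, written in one-line notation. West's stack-sorting map $s$ is defined recursively: $s$ sends the empty permutation to itself, and for a nonempty permutation $\pi=LmR$ with $m$ its largest entry, $s(\pi)=s(L)\,s(R)\,m$; $s^t$ is the $t$-fold iterate. For a nonempty permutation $\pi$, $\operatorname{del}_1(\pi)$ is the permutation obtained by deleting the smallest entry of $\pi$. -}

module Defs where

import Data.Nat
open Data.Nat using (ℕ; zero; suc; _<_; _≤ᵇ_; _⊔_; _⊓_)
open import Data.List using (List; []; _∷_; _++_; length; foldr)
open import Data.List.Relation.Unary.All using (All)
open import Data.List.Relation.Unary.Unique.Propositional using (Unique)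
import Data.Product
open Data.Product using (_×_)
import Data.Bool
open Data.Bool using (if_then_else_)
open import Relation.Binary.PropositionalEquality using (_≡_)
open import Relation.Nullary using (¬_)
open import Function using (_∘_)

-- A permutation in one-line notation: a list of distinct positive integers.
IsPerm : List ℕ → Set
IsPerm π = Unique π × All (λ x → 0 < x) π

-- Largest entry of a list (0 for the empty list; entries are positive).
maxL : List ℕ → ℕ
maxL = foldr _⊔_ 0

splitAt : ℕ → List ℕ → List ℕ Data.Product.× List ℕ
splitAt m [] = [] Data.Product., []
splitAt m (x ∷ xs) with m Data.Nat.≡ᵇ x
... | Data.Bool.true = [] Data.Product., xs
... | Data.Bool.false = let r = splitAt m xs in (x ∷ Data.Product.proj₁ r) Data.Product., Data.Product.proj₂ r

-- West's stack-sorting map with fuel (fuel ≥ length suffices).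
sF : ℕ → List ℕ → List ℕ
sF zero _ = []
sF (suc n) [] = []
sF (suc n) (x ∷ xs) =
  let m = maxL (x ∷ xs)
      r = splitAt m (x ∷ xs)
  in sF n (Data.Product.proj₁ r) ++ (sF n (Data.Product.proj₂ r) ++ (m ∷ []))

-- s(π) = s(L) s(R) m  where π = L m R, m the largest entry; s(∅) = ∅.
s : List ℕ → List ℕ
s π = sF (length π) π

iter : ℕ → (List ℕ → List ℕ) → List ℕ → List ℕ
iter zero f = λ x → x
iter (suc t) f = f ∘ iter t f

minL : ℕ → List ℕ → ℕ
minL = foldr _⊓_

remove : ℕ → List ℕ → List ℕ
remove m [] = []
remove m (x ∷ xs) = if m Data.Nat.≡ᵇ x then xs else x ∷ remove m xs

-- del₁ : delete the smallest entry (identity on the empty list, which never arises).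
del₁ : List ℕ → List ℕ
del₁ [] = []
del₁ (x ∷ xs) = remove (minL x xs) (x ∷ xs)

module Submission where

-- For any lower bound a of the entries of π, deleting a commutes with s. Split π = L m R at
-- the first occurrence of its maximum m, so that s(π) = s(L) s(R) m. If a occurs in L, it is
-- deleted from L on both sides; otherwise it is deleted from R (or not at all); and if a = m,
-- all entries equal m and both sides are R. Since s^t(π) is a rearrangement of π, the smallest
-- entry of π stays a lower bound along the iteration, and del₁ of s^t(π) deletes that entry.
-- Distinctness of the entries is never used.

open import Defs
open import Data.Nat using (ℕ; zero; suc; _≤_; _⊔_; _+_; z≤n; s≤s)
open import Data.Nat.Properties
open import Data.List using (List; []; _∷_; _++_; [_]; length)
open import Data.List.Properties using (length-++)
open import Data.List.Relation.Unary.All as All using (All; []; _∷_)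
open import Data.List.Relation.Unary.All.Properties using (++⁻; ¬Any⇒All¬)
  renaming (++⁺ to All-++⁺)
open import Data.List.Relation.Unary.Any using (here; there)
open import Data.List.Membership.Propositional using (_∈_)
open import Data.List.Membership.Propositional.Properties using (∈-++⁺ʳ; foldr-selective)
open import Data.List.Membership.DecPropositional _≟_ using (_∈?_)
open import Data.List.Relation.Binary.Permutation.Propositional using (_↭_; ↭-sym; ↭-refl; ↭-trans)
open import Data.List.Relation.Binary.Permutation.Propositional.Properties
  using (∈-resp-↭; All-resp-↭; ++⁺; ++-comm)
open import Data.Product using (∃-syntax; _×_; _,_; proj₁; proj₂)
open import Data.Sum using (inj₁; inj₂; [_,_]′)
open import Data.Empty using (⊥-elim)
open import Relation.Nullary using (yes; no)
open import Relation.Nullary.Decidable using (dec-true; dec-false)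
open import Relation.Binary.PropositionalEquality
  using (_≡_; _≢_; refl; sym; trans; cong; cong₂; subst; module ≡-Reasoning)
open ≡-Reasoning

remove-head : ∀ a xs → remove a (a ∷ xs) ≡ xs
remove-head a xs rewrite dec-true (a ≟ a) refl = refl

remove-∷-≢ : ∀ {a x} xs → a ≢ x → remove a (x ∷ xs) ≡ x ∷ remove a xs
remove-∷-≢ {a} {x} xs a≢x rewrite dec-false (a ≟ x) a≢x = refl

remove-++ˡ : ∀ {a} xs ys → a ∈ xs → remove a (xs ++ ys) ≡ remove a xs ++ ys
remove-++ˡ (x ∷ xs) ys (here refl) rewrite dec-true (x ≟ x) refl = refl
remove-++ˡ {a} (x ∷ xs) ys (there a∈xs) with a ≟ x
... | yes refl rewrite dec-true (x ≟ x) refl = refl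
... | no a≢x rewrite dec-false (a ≟ x) a≢x =
  cong (x ∷_) (remove-++ˡ xs ys a∈xs)

remove-++ʳ : ∀ {a} xs ys → All (a ≢_) xs → remove a (xs ++ ys) ≡ xs ++ remove a ys
remove-++ʳ []       ys []            = refl
remove-++ʳ (x ∷ xs) ys (a≢x ∷ a∉xs) rewrite remove-∷-≢ (xs ++ ys) a≢x =
  cong (x ∷_) (remove-++ʳ xs ys a∉xs)

remove-∷ʳ : ∀ {a m} xs → a ≢ m → remove a (xs ++ [ m ]) ≡ remove a xs ++ [ m ]
remove-∷ʳ {a} []       a≢m = remove-∷-≢ [] a≢m
remove-∷ʳ {a} (x ∷ xs) a≢m with a ≟ x
... | yes refl rewrite dec-true (x ≟ x) refl = refl
... | no a≢x rewrite dec-false (a ≟ x) a≢x =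
  cong (x ∷_) (remove-∷ʳ xs a≢m)

All-remove : ∀ {P : ℕ → Set} a {xs} → All P xs → All P (remove a xs)
All-remove a [] = []
All-remove a {x ∷ xs} (px ∷ pxs) with a ≟ x
... | yes refl rewrite remove-head x xs = pxs
... | no a≢x rewrite remove-∷-≢ xs a≢x = px ∷ All-remove a pxs

splitAt-++ : ∀ m L R → All (m ≢_) L → splitAt m (L ++ m ∷ R) ≡ (L , R)
splitAt-++ m []      R []            rewrite dec-true (m ≟ m) refl = refl
splitAt-++ m (x ∷ L) R (m≢x ∷ m∉L) rewrite dec-false (m ≟ x) m≢x | splitAt-++ m L R m∉L = refl

∈⇒first-split : ∀ {m xs} → m ∈ xs → ∃[ L ] ∃[ R ] (xs ≡ L ++ m ∷ R × All (m ≢_) L)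
∈⇒first-split {xs = x ∷ xs} (here refl) = [] , xs , refl , []
∈⇒first-split {m} {x ∷ xs} (there m∈xs) with m ≟ x
... | yes refl = [] , xs , refl , []
... | no m≢x with ∈⇒first-split m∈xs
...   | L , R , refl , m∉L = x ∷ L , R , refl , m≢x ∷ m∉L

maxL-ub : ∀ xs → All (_≤ maxL xs) xs
maxL-ub []       = []
maxL-ub (x ∷ xs) = m≤m⊔n x (maxL xs) ∷ All.map (m≤n⇒m≤o⊔n x) (maxL-ub xs)

maxL-lub : ∀ {m} xs → All (_≤ m) xs → maxL xs ≤ m
maxL-lub []       []            = z≤n
maxL-lub (x ∷ xs) (x≤m ∷ xs≤m) = ⊔-lub x≤m (maxL-lub xs xs≤m)

maxL-∈ : ∀ x xs → maxL (x ∷ xs) ∈ x ∷ xs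
maxL-∈ x []       rewrite ⊔-identityʳ x = here refl
maxL-∈ x (y ∷ ys) with ⊔-sel x (maxL (y ∷ ys))
... | inj₁ max≡x = subst (_∈ x ∷ y ∷ ys) (sym max≡x) (here refl)
... | inj₂ max≡max-ys = subst (_∈ x ∷ y ∷ ys) (sym max≡max-ys) (there (maxL-∈ y ys))

maxL-unique : ∀ {m xs} → m ∈ xs → All (_≤ m) xs → maxL xs ≡ m
maxL-unique {xs = xs} m∈xs xs≤m = ≤-antisym (maxL-lub xs xs≤m) (All.lookup (maxL-ub xs) m∈xs)

minL-lb : ∀ x xs → All (minL x xs ≤_) (x ∷ xs)
minL-lb x []       = ≤-refl ∷ []
minL-lb x (y ∷ ys) with minL-lb x ys
... | min≤x ∷ min≤ys =
  m≤n⇒o⊓m≤n y min≤x ∷ m⊓n≤m y (minL x ys) ∷ All.map (m≤n⇒o⊓m≤n y) min≤ys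

minL-∈ : ∀ x xs → minL x xs ∈ x ∷ xs
minL-∈ x xs = [ here , there ]′ (foldr-selective ⊓-sel x xs)

record FirstMax (L : List ℕ) (m : ℕ) (R : List ℕ) : Set where
  field
    m∉L : All (m ≢_) L
    L≤m : All (_≤ m) L
    R≤m : All (_≤ m) R
open FirstMax

maxSplit : ∀ x xs → ∃[ L ] ∃[ m ] ∃[ R ] (x ∷ xs ≡ L ++ m ∷ R × FirstMax L m R)
maxSplit x xs with ∈⇒first-split (maxL-∈ x xs)
... | L , R , eq , first = L , _ , R , eq ,
      record { m∉L = first ; L≤m = proj₁ bounds ; R≤m = All.tail (proj₂ bounds) }
  where bounds = ++⁻ L (subst (All (_≤ maxL (x ∷ xs))) eq (maxL-ub (x ∷ xs)))

length-++-∷ : ∀ L (m : ℕ) R → length (L ++ m ∷ R) ≡ suc (length L + length R)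
length-++-∷ L m R = trans (length-++ L) (+-suc (length L) (length R))

sides-≤ : ∀ {n} L (m : ℕ) R → length (L ++ m ∷ R) ≤ suc n → length L ≤ n × length R ≤ n
sides-≤ L m R len≤ with subst (_≤ _) (length-++-∷ L m R) len≤
... | s≤s L+R≤n = ≤-trans (m≤m+n _ _) L+R≤n , ≤-trans (m≤n+m _ _) L+R≤n

maxSplit-ind : (P : List ℕ → Set) → P [] →
               (∀ {L m R} → FirstMax L m R → P L → P R → P (L ++ m ∷ R)) → ∀ π → P π
maxSplit-ind P P[] step π = go (length π) π ≤-refl
  where
    go : ∀ n π → length π ≤ n → P π
    go _       []       _ = P[]
    go (suc n) (x ∷ xs) len≤ with maxSplit x xs
    ... | L , m , R , eq , fm with sides-≤ L m R (subst (λ σ → length σ ≤ suc n) eq len≤)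
    ...   | L≤n , R≤n = subst P (sym eq) (step fm (go n L L≤n) (go n R R≤n))

sF-[] : ∀ n → sF n [] ≡ []
sF-[] zero    = refl
sF-[] (suc n) = refl

++-∷≢[] : ∀ L (m : ℕ) R → L ++ m ∷ R ≢ []
++-∷≢[] []      m R ()
++-∷≢[] (_ ∷ _) m R ()

sF-suc : ∀ n π → π ≢ [] → sF (suc n) π ≡
  sF n (proj₁ (splitAt (maxL π) π)) ++ (sF n (proj₂ (splitAt (maxL π) π)) ++ [ maxL π ])
sF-suc n []       π≢[] = ⊥-elim (π≢[] refl)
sF-suc n (x ∷ xs) _    = refl

sF-++-∷ : ∀ n {L m R} → FirstMax L m R → sF (suc n) (L ++ m ∷ R) ≡ sF n L ++ (sF n R ++ [ m ])
sF-++-∷ n {L} {m} {R} fm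
  rewrite sF-suc n (L ++ m ∷ R) (++-∷≢[] L m R)
        | maxL-unique (∈-++⁺ʳ L (here refl)) (All-++⁺ (L≤m fm) (≤-refl ∷ R≤m fm))
        | splitAt-++ m L R (m∉L fm) = refl

sF-fuel : ∀ k n π → length π ≤ k → length π ≤ n → sF k π ≡ sF n π
sF-fuel k       n       []       _    _    = trans (sF-[] k) (sym (sF-[] n))
sF-fuel (suc k) (suc n) (x ∷ xs) len≤k len≤n with maxSplit x xs
... | L , m , R , eq , fm with sides-≤ L m R (subst (λ σ → length σ ≤ suc k) eq len≤k)
                             | sides-≤ L m R (subst (λ σ → length σ ≤ suc n) eq len≤n)
...   | L≤k , R≤k | L≤n , R≤n = begin
  sF (suc k) (x ∷ xs)            ≡⟨ cong (sF (suc k)) eq ⟩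
  sF (suc k) (L ++ m ∷ R)        ≡⟨ sF-++-∷ k fm ⟩
  sF k L ++ (sF k R ++ [ m ])    ≡⟨ cong₂ (λ sL sR → sL ++ (sR ++ [ m ]))
                                          (sF-fuel k n L L≤k L≤n) (sF-fuel k n R R≤k R≤n) ⟩
  sF n L ++ (sF n R ++ [ m ])    ≡⟨ sF-++-∷ n fm ⟨
  sF (suc n) (L ++ m ∷ R)        ≡⟨ cong (sF (suc n)) eq ⟨
  sF (suc n) (x ∷ xs)            ∎

s-++-∷ : ∀ {L m R} → FirstMax L m R → s (L ++ m ∷ R) ≡ s L ++ (s R ++ [ m ])
s-++-∷ {L} {m} {R} fm = begin
  sF (length (L ++ m ∷ R)) (L ++ m ∷ R)  ≡⟨ cong (λ k → sF k (L ++ m ∷ R)) (length-++-∷ L m R) ⟩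
  sF (suc n) (L ++ m ∷ R)                ≡⟨ sF-++-∷ n fm ⟩
  sF n L ++ (sF n R ++ [ m ])            ≡⟨ cong₂ (λ sL sR → sL ++ (sR ++ [ m ]))
                                                  (sF-fuel n _ L (m≤m+n _ _) ≤-refl)
                                                  (sF-fuel n _ R (m≤n+m _ _) ≤-refl) ⟩
  s L ++ (s R ++ [ m ])                  ∎
  where n = length L + length R

s-↭ : ∀ π → s π ↭ π
s-↭ = maxSplit-ind (λ π → s π ↭ π) ↭-refl step
  where
    step : ∀ {L m R} → FirstMax L m R → s L ↭ L → s R ↭ R → s (L ++ m ∷ R) ↭ L ++ m ∷ R
    step {L} {m} {R} fm sL↭L sR↭R = subst (_↭ L ++ m ∷ R) (sym (s-++-∷ fm))
      (++⁺ sL↭L (↭-trans (++⁺ sR↭R ↭-refl) (++-comm R [ m ])))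

∷ʳ-const : ∀ {m : ℕ} {R} → All (_≡ m) R → R ++ [ m ] ≡ m ∷ R
∷ʳ-const []           = refl
∷ʳ-const (refl ∷ R≡m) = cong (_ ∷_) (∷ʳ-const R≡m)

s-const : ∀ {m R} → All (_≡ m) R → s R ≡ R
s-const [] = refl
s-const {m} {_ ∷ R} (refl ∷ R≡m) = begin
  s ([] ++ m ∷ R)    ≡⟨ s-++-∷ record { m∉L = [] ; L≤m = [] ; R≤m = All.map ≤-reflexive R≡m } ⟩
  s R ++ [ m ]       ≡⟨ cong (_++ [ m ]) (s-const R≡m) ⟩
  R ++ [ m ]         ≡⟨ ∷ʳ-const R≡m ⟩
  m ∷ R              ∎

s-remove-lowerBound-max : ∀ {L a R} → FirstMax L a R → All (a ≤_) (L ++ a ∷ R) →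
               s (remove a (L ++ a ∷ R)) ≡ remove a (s (L ++ a ∷ R))
s-remove-lowerBound-max {x ∷ L} fm (a≤x ∷ _) = ⊥-elim (All.head (m∉L fm) (≤-antisym a≤x (All.head (L≤m fm))))
s-remove-lowerBound-max {[]} {a} {R} fm (_ ∷ a≤R) = begin
  s (remove a (a ∷ R))       ≡⟨ cong s (remove-head a R) ⟩
  s R                        ≡⟨ s-const R≡a ⟩
  R                          ≡⟨ remove-head a R ⟨
  remove a (a ∷ R)           ≡⟨ cong (remove a) (∷ʳ-const R≡a) ⟨
  remove a (R ++ [ a ])      ≡⟨ cong (λ sR → remove a (sR ++ [ a ])) (s-const R≡a) ⟨
  remove a (s R ++ [ a ])    ≡⟨ cong (remove a) (s-++-∷ fm) ⟨
  remove a (s (a ∷ R))       ∎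
  where
    R≡a : All (_≡ a) R
    R≡a = All.zipWith (λ (x≤a , a≤x) → ≤-antisym x≤a a≤x) (R≤m fm , a≤R)

s-remove-lowerBound : ∀ a π → All (a ≤_) π → s (remove a π) ≡ remove a (s π)
s-remove-lowerBound a = maxSplit-ind P (λ _ → refl) step
  where
    P : List ℕ → Set
    P π = All (a ≤_) π → s (remove a π) ≡ remove a (s π)

    step : ∀ {L m R} → FirstMax L m R → P L → P R → P (L ++ m ∷ R)
    step {L} {m} {R} fm ihL ihR a≤π with a ≟ m | a ∈? L | ++⁻ L a≤π
    ... | yes refl | _ | _ = s-remove-lowerBound-max fm a≤π
    ... | no _   | yes a∈L | a≤L , _ = begin
      s (remove a (L ++ m ∷ R))            ≡⟨ cong s (remove-++ˡ L (m ∷ R) a∈L) ⟩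
      s (remove a L ++ m ∷ R)              ≡⟨ s-++-∷ fm′ ⟩
      s (remove a L) ++ (s R ++ [ m ])     ≡⟨ cong (_++ (s R ++ [ m ])) (ihL a≤L) ⟩
      remove a (s L) ++ (s R ++ [ m ])     ≡⟨ remove-++ˡ (s L) _ (∈-resp-↭ (↭-sym (s-↭ L)) a∈L) ⟨
      remove a (s L ++ (s R ++ [ m ]))     ≡⟨ cong (remove a) (s-++-∷ fm) ⟨
      remove a (s (L ++ m ∷ R))            ∎
      where
        fm′ = record { m∉L = All-remove a (m∉L fm) ; L≤m = All-remove a (L≤m fm) ; R≤m = R≤m fm }
    ... | no a≢m | no a∉L | _ , _ ∷ a≤R = begin
      s (remove a (L ++ m ∷ R))            ≡⟨ cong s (remove-++ʳ L (m ∷ R) a≢L) ⟩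
      s (L ++ remove a (m ∷ R))            ≡⟨ cong (λ σ → s (L ++ σ)) (remove-∷-≢ R a≢m) ⟩
      s (L ++ m ∷ remove a R)              ≡⟨ s-++-∷ fm′ ⟩
      s L ++ (s (remove a R) ++ [ m ])     ≡⟨ cong (λ sR → s L ++ (sR ++ [ m ])) (ihR a≤R) ⟩
      s L ++ (remove a (s R) ++ [ m ])     ≡⟨ cong (s L ++_) (remove-∷ʳ (s R) a≢m) ⟨
      s L ++ remove a (s R ++ [ m ])       ≡⟨ remove-++ʳ (s L) _ (All-resp-↭ (↭-sym (s-↭ L)) a≢L) ⟨
      remove a (s L ++ (s R ++ [ m ]))     ≡⟨ cong (remove a) (s-++-∷ fm) ⟨
      remove a (s (L ++ m ∷ R))            ∎
      where
        a≢L = ¬Any⇒All¬ L a∉L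
        fm′ = record { m∉L = m∉L fm ; L≤m = L≤m fm ; R≤m = All-remove a (R≤m fm) }

iter-preserves : ∀ {Q : List ℕ → Set} {f : List ℕ → List ℕ} → (∀ π → Q π → Q (f π)) → ∀ t π → Q π → Q (iter t f π)
iter-preserves f-pres zero    π Qπ = Qπ
iter-preserves f-pres (suc t) π Qπ = f-pres _ (iter-preserves f-pres t π Qπ)

iter-↭ : ∀ {f : List ℕ → List ℕ} → (∀ π → f π ↭ π) → ∀ t π → iter t f π ↭ π
iter-↭ f↭ t π = iter-preserves {Q = _↭ π} (λ σ → ↭-trans (f↭ σ)) t π ↭-refl

iter-comm : ∀ {Q : List ℕ → Set} {f g : List ℕ → List ℕ} → (∀ π → Q π → Q (f π)) →
            (∀ π → Q π → f (g π) ≡ g (f π)) → ∀ t π → Q π → iter t f (g π) ≡ g (iter t f π)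
iter-comm         f-pres comm zero    π Qπ = refl
iter-comm {f = f} f-pres comm (suc t) π Qπ =
  trans (cong f (iter-comm f-pres comm t π Qπ)) (comm _ (iter-preserves f-pres t π Qπ))

del₁-↭ : ∀ {x xs σ} → σ ↭ x ∷ xs → del₁ σ ≡ remove (minL x xs) σ
del₁-↭ {x} {xs} {[]} σ↭π with ∈-resp-↭ (↭-sym σ↭π) (here {xs = xs} refl)
... | ()
del₁-↭ {x} {xs} {y ∷ ys} σ↭π = cong (λ b → remove b (y ∷ ys)) (≤-antisym min-σ≤min-π min-π≤min-σ)
  where
    min-σ≤min-π = All.lookup (minL-lb y ys) (∈-resp-↭ (↭-sym σ↭π) (minL-∈ x xs))
    min-π≤min-σ = All.lookup (minL-lb x xs) (∈-resp-↭ σ↭π (minL-∈ y ys))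

lemma2p3 : (π : List ℕ) → IsPerm π → π ≢ [] → (t : ℕ) → iter t s (del₁ π) ≡ del₁ (iter t s π)
lemma2p3 []       _ π≢[] t = ⊥-elim (π≢[] refl)
lemma2p3 (x ∷ xs) _ _    t = begin
  iter t s (remove a (x ∷ xs))  ≡⟨ iter-comm {g = remove a} (λ π → All-resp-↭ (↭-sym (s-↭ π)))
                                             (s-remove-lowerBound a) t (x ∷ xs) (minL-lb x xs) ⟩
  remove a (iter t s (x ∷ xs))  ≡⟨ del₁-↭ (iter-↭ s-↭ t (x ∷ xs)) ⟨
  del₁ (iter t s (x ∷ xs))      ∎
  where a = minL x xs
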